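{- Let $\phi$ be a compatible and conservative functorial interpretation of a polygraphic program $\Pi$. Then for every $3$-path $F$ of $\Pi$, the inequality $\partial_\phi(s_2F)\ge\partial_\phi(t_2F)$ holds pointwise.
   Context: A 3-polygraph freely generates a strict $3$-category whose $k$-morphisms are $k$-paths, composed by $\star_j$ ($0\le j<k$); $s_j,t_j$ are $j$-source/target. A polygraphic program is a finite 3-polygraph with a single $0$-cell (its classification of cells plays no role here). A functorial interpretation $\phi$ assigns to each $1$-path $u$ with $n$ $1$-cells a nonempty $\phi(u)\subseteq(\mathbb{N}\setminus\{0\})^n$ and to each $2$-path $f:u\Rightarrow v$ a monotone map $\phi(f):\phi(u)\to\phi(v)$ (product order), with $\phi(u\star_0v)=\phi(u)\times\phi(v)$, $\phi(f\star_0g)=\phi(f)\times\phi(g)$, $\phi(f\star_1g)=\phi(g)\circ\phi(f)$, identities to identities; it is compatible if $\phi(s_2\alpha)\ge\phi(t_2\alpha)$ for every $3$-cell $\alpha$. $\partial_\phi$ is the unique map sending each $2$-path $f$ with $1$-source $u$ to a monotone map $\partial_\phi f:\phi(u)\to\mathbb{N}$ such that $\partial_\phi(\text{identity})=0$, $\partial_\phi(f\star_0g)(x,y)=\max\{\partial_\phi f(x),\partial_\phi g(y)\}$, $\partial_\phi(f\star_1g)=\max\{\partial_\phi f,\partial_\phi g\circ\phi(f)\}$, and for each $2$-cell $c$ of arity $m$ and coarity $n$, $\partial_\phi c(x_1,\dots,x_m)=\max\{x_1,\dots,x_m,y_1,\dots,y_n\}$ with $(y_1,\dots,y_n)=\phi(c)(x_1,\dots,x_m)$.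 $\phi$ is conservative if $\partial_\phi(s_2\alpha)\ge\partial_\phi(t_2\alpha)$ pointwise for every $3$-cell $\alpha$. -}

module Defs where

open import Data.Nat using (ℕ; zero; suc; _≤_; _⊔_)
open import Data.Fin using (Fin)
open import Data.List using (List; []; _∷_; _++_)
open import Data.List.Relation.Unary.All using (All; []; _∷_)
open import Data.Product using (Σ; _×_; _,_; proj₁; proj₂)
open import Data.Unit using (⊤)

-- Finite 2- and 3-polygraphs with a single 0-cell.
-- 1-cells: Fin n₁ ; 1-paths: List (Fin n₁) (⋆₀ on 1-paths is _++_).

record Polygraph2 : Set where
  field
    n₁ : ℕ
    n₂ : ℕ
    src₂ : Fin n₂ → List (Fin n₁)
    tgt₂ : Fin n₂ → List (Fin n₁)

open Polygraph2 public

Path1 : Polygraph2 → Set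
Path1 P = List (Fin (n₁ P))

data Path2 (P : Polygraph2) : Path1 P → Path1 P → Set where
  gen  : (c : Fin (n₂ P)) → Path2 P (src₂ P c) (tgt₂ P c)
  idp  : (u : Path1 P) → Path2 P u u
  _⋆₀_ : ∀ {u v u' v'} → Path2 P u v → Path2 P u' v' → Path2 P (u ++ u') (v ++ v')
  _⋆₁_ : ∀ {u v w} → Path2 P u v → Path2 P v w → Path2 P u w

-- The congruence generated by the axioms of strict 2-categories
-- (heterogeneous, since ⋆₀-associativity/units change the index
-- expressions only up to propositional equality).  2-paths of the free
-- 2-category are Path2 modulo _≈₂_.
data _≈₂_ {P : Polygraph2} : ∀ {u v u' v'} → Path2 P u v → Path2 P u' v' → Set where
  ≈refl  : ∀ {u v} {f : Path2 P u v} → f ≈₂ f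
  ≈sym   : ∀ {u v u' v'} {f : Path2 P u v} {g : Path2 P u' v'} → f ≈₂ g → g ≈₂ f
  ≈trans : ∀ {u v u' v' u'' v''} {f : Path2 P u v} {g : Path2 P u' v'} {h : Path2 P u'' v''} →
           f ≈₂ g → g ≈₂ h → f ≈₂ h
  ≈cong₀ : ∀ {u v u' v' a b a' b'} {f : Path2 P u v} {f' : Path2 P u' v'}
             {g : Path2 P a b} {g' : Path2 P a' b'} →
           f ≈₂ f' → g ≈₂ g' → (f ⋆₀ g) ≈₂ (f' ⋆₀ g')
  ≈cong₁ : ∀ {u v w u' v' w'} {f : Path2 P u v} {f' : Path2 P u' v'}
             {g : Path2 P v w} {g' : Path2 P v' w'} →
           f ≈₂ f' → g ≈₂ g' → (f ⋆₁ g) ≈₂ (f' ⋆₁ g')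
  assoc₁ : ∀ {u v w x} {f : Path2 P u v} {g : Path2 P v w} {h : Path2 P w x} →
           ((f ⋆₁ g) ⋆₁ h) ≈₂ (f ⋆₁ (g ⋆₁ h))
  unitl₁ : ∀ {u v} {f : Path2 P u v} → (idp u ⋆₁ f) ≈₂ f
  unitr₁ : ∀ {u v} {f : Path2 P u v} → (f ⋆₁ idp v) ≈₂ f
  assoc₀ : ∀ {u v u' v' u'' v''} {f : Path2 P u v} {g : Path2 P u' v'} {h : Path2 P u'' v''} →
           ((f ⋆₀ g) ⋆₀ h) ≈₂ (f ⋆₀ (g ⋆₀ h))
  unitl₀ : ∀ {u v} {f : Path2 P u v} → (idp [] ⋆₀ f) ≈₂ f
  unitr₀ : ∀ {u v} {f : Path2 P u v} → (f ⋆₀ idp []) ≈₂ f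
  idid₀  : ∀ {u v} → (idp u ⋆₀ idp v) ≈₂ idp {P} (u ++ v)
  exch   : ∀ {u v w u' v' w'} {f : Path2 P u v} {g : Path2 P v w}
             {f' : Path2 P u' v'} {g' : Path2 P v' w'} →
           ((f ⋆₀ f') ⋆₁ (g ⋆₀ g')) ≈₂ ((f ⋆₁ g) ⋆₀ (f' ⋆₁ g'))

record Polygraph3 : Set where
  field
    P2   : Polygraph2
    n₃   : ℕ
    dom₃ : Fin n₃ → Path1 P2
    cod₃ : Fin n₃ → Path1 P2
    s₃   : (α : Fin n₃) → Path2 P2 (dom₃ α) (cod₃ α)
    t₃   : (α : Fin n₃) → Path2 P2 (dom₃ α) (cod₃ α)

open Polygraph3 public

-- 3-paths of the free 3-category, typed by their 2-source and 2-target.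
-- (Only s₂/t₂ matter, so no quotient on 3-paths is needed; conv
-- provides identities on 2-paths up to the 2-category axioms.)
data Path3 (Π : Polygraph3) : ∀ {u v} → Path2 (P2 Π) u v → Path2 (P2 Π) u v → Set where
  gen3 : (α : Fin (n₃ Π)) → Path3 Π (s₃ Π α) (t₃ Π α)
  conv : ∀ {u v} {f g : Path2 (P2 Π) u v} → f ≈₂ g → Path3 Π f g
  _⋆₀³_ : ∀ {u v u' v'} {f g : Path2 (P2 Π) u v} {f' g' : Path2 (P2 Π) u' v'} →
          Path3 Π f g → Path3 Π f' g' → Path3 Π (f ⋆₀ f') (g ⋆₀ g')
  _⋆₁³_ : ∀ {u v w} {f g : Path2 (P2 Π) u v} {f' g' : Path2 (P2 Π) v w} →
          Path3 Π f g → Path3 Π f' g' → Path3 Π (f ⋆₁ f') (g ⋆₁ g')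
  _⋆₂³_ : ∀ {u v} {f g h : Path2 (P2 Π) u v} →
          Path3 Π f g → Path3 Π g h → Path3 Π f h

-- Functorial interpretations, given by their (unique functorial)
-- values on generating 1- and 2-cells.

Pt : ∀ {n} → (Fin n → ℕ → Set) → List (Fin n) → Set
Pt S u = All (λ a → Σ ℕ (S a)) u

_≤ₚ_ : ∀ {n} {S : Fin n → ℕ → Set} {u : List (Fin n)} → Pt S u → Pt S u → Set
[] ≤ₚ [] = ⊤
(x ∷ xs) ≤ₚ (y ∷ ys) = (proj₁ x ≤ proj₁ y) × (xs ≤ₚ ys)

maxPt : ∀ {n} {S : Fin n → ℕ → Set} {u : List (Fin n)} → Pt S u → ℕ
maxPt [] = 0
maxPt (x ∷ xs) = proj₁ x ⊔ maxPt xs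

splitPt : ∀ {n} {S : Fin n → ℕ → Set} (u : List (Fin n)) {u' : List (Fin n)} →
          Pt S (u ++ u') → Pt S u × Pt S u'
splitPt [] xs = [] , xs
splitPt (a ∷ u) (x ∷ xs) with splitPt u xs
... | (l , r) = (x ∷ l) , r

_++ₚ_ : ∀ {n} {S : Fin n → ℕ → Set} {u u' : List (Fin n)} →
        Pt S u → Pt S u' → Pt S (u ++ u')
[] ++ₚ ys = ys
(x ∷ xs) ++ₚ ys = x ∷ (xs ++ₚ ys)

record Interpretation (P : Polygraph2) : Set₁ where
  field
    Sub    : Fin (n₁ P) → ℕ → Set
    Sub-pos : ∀ a n → Sub a n → 1 ≤ n
    Sub-ne : ∀ a → Σ ℕ (Sub a)
    map₂   : (c : Fin (n₂ P)) → Pt Sub (src₂ P c) → Pt Sub (tgt₂ P c)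
    mono₂  : (c : Fin (n₂ P)) (x y : Pt Sub (src₂ P c)) →
             x ≤ₚ y → map₂ c x ≤ₚ map₂ c y

open Interpretation public

⟦_⟧ : ∀ {P} {φ : Interpretation P} {u v} → Path2 P u v → Pt (Sub φ) u → Pt (Sub φ) v
⟦_⟧ {φ = φ} (gen c) x = map₂ φ c x
⟦ idp u ⟧ x = x
⟦_⟧ {φ = φ} (_⋆₀_ {u = u} f g) x with splitPt u x
... | (x₁ , x₂) = ⟦_⟧ {φ = φ} f x₁ ++ₚ ⟦_⟧ {φ = φ} g x₂
⟦_⟧ {φ = φ} (f ⋆₁ g) x = ⟦_⟧ {φ = φ} g (⟦_⟧ {φ = φ} f x)

∂ : ∀ {P} (φ : Interpretation P) {u v} → Path2 P u v → Pt (Sub φ) u → ℕ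
∂ φ (gen c) x = maxPt x ⊔ maxPt (map₂ φ c x)
∂ φ (idp u) x = 0
∂ φ (_⋆₀_ {u = u} f g) x with splitPt u x
... | (x₁ , x₂) = ∂ φ f x₁ ⊔ ∂ φ g x₂
∂ φ (f ⋆₁ g) x = ∂ φ f x ⊔ ∂ φ g (⟦_⟧ {φ = φ} f x)

Compatible : (Π : Polygraph3) → Interpretation (P2 Π) → Set
Compatible Π φ = ∀ α (x : Pt (Sub φ) (dom₃ Π α)) →
  ⟦_⟧ {φ = φ} (t₃ Π α) x ≤ₚ ⟦_⟧ {φ = φ} (s₃ Π α) x

Conservative : (Π : Polygraph3) → Interpretation (P2 Π) → Set
Conservative Π φ = ∀ α (x : Pt (Sub φ) (dom₃ Π α)) →
  ∂ φ (t₃ Π α) x ≤ ∂ φ (s₃ Π α) x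

{-# OPTIONS --safe #-}
module Submission where

-- The axioms of strict 2-categories hold on the nose for ⟦_⟧ and ∂, so both
-- are invariant under ≈₂.  Along a 3-path, ⟦_⟧ then decreases by compatibility
-- and ∂ by conservativity; in a ⋆₁³-composite the second factor is evaluated
-- at ⟦ g ⟧ x ≤ ⟦ f ⟧ x, which is where monotonicity of ∂ and the decrease of
-- ⟦_⟧ enter.

open import Defs
open import Data.Nat using (ℕ; _≤_; _⊔_; z≤n)
open import Data.Nat.Properties
  using (≤-refl; ≤-trans; ≤-reflexive; ⊔-mono-≤; ⊔-assoc; ⊔-identityʳ; ⊔-commutativeSemigroup)
open import Algebra.Properties.CommutativeSemigroup ⊔-commutativeSemigroup using (interchange)
open import Data.Fin using (Fin)
open import Data.List using (List; []; _∷_; _++_)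
open import Data.List.Properties using (∷-injective; ++-assoc; ++-identityʳ)
open import Data.List.Relation.Unary.All using ([]; _∷_)
open import Data.Product using (Σ; _×_; _,_; proj₁; proj₂)
open import Data.Unit using (tt)
open import Relation.Binary.PropositionalEquality
  using (_≡_; refl; sym; trans; cong; cong₂; module ≡-Reasoning)

module _ {n : ℕ} {S : Fin n → ℕ → Set} where

  ≤ₚ-refl : ∀ {u} (x : Pt S u) → x ≤ₚ x
  ≤ₚ-refl []       = tt
  ≤ₚ-refl (x ∷ xs) = ≤-refl , ≤ₚ-refl xs

  ≤ₚ-reflexive : ∀ {u} {x y : Pt S u} → x ≡ y → x ≤ₚ y
  ≤ₚ-reflexive {x = x} refl = ≤ₚ-refl x

  ≤ₚ-trans : ∀ {u} (x y z : Pt S u) → x ≤ₚ y → y ≤ₚ z → x ≤ₚ z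
  ≤ₚ-trans []       []       []       _        _        = tt
  ≤ₚ-trans (x ∷ xs) (y ∷ ys) (z ∷ zs) (p , ps) (q , qs) = ≤-trans p q , ≤ₚ-trans xs ys zs ps qs

  maxPt-mono : ∀ {u} (x y : Pt S u) → x ≤ₚ y → maxPt x ≤ maxPt y
  maxPt-mono []       []       _        = z≤n
  maxPt-mono (x ∷ xs) (y ∷ ys) (p , ps) = ⊔-mono-≤ p (maxPt-mono xs ys ps)

  splitPt-mono : ∀ u {w} (x y : Pt S (u ++ w)) → x ≤ₚ y →
                 (proj₁ (splitPt u x) ≤ₚ proj₁ (splitPt u y)) × (proj₂ (splitPt u x) ≤ₚ proj₂ (splitPt u y))
  splitPt-mono []      x        y        p        = tt , p
  splitPt-mono (a ∷ u) (x ∷ xs) (y ∷ ys) (p , ps) with splitPt-mono u xs ys ps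
  ... | q₁ , q₂ = (p , q₁) , q₂

  ++ₚ-mono : ∀ {u w} (x y : Pt S u) (x′ y′ : Pt S w) → x ≤ₚ y → x′ ≤ₚ y′ → (x ++ₚ x′) ≤ₚ (y ++ₚ y′)
  ++ₚ-mono []       []       x′ y′ _        q = q
  ++ₚ-mono (x ∷ xs) (y ∷ ys) x′ y′ (p , ps) q = p , ++ₚ-mono xs ys x′ y′ ps q

  splitPt-++ₚ : ∀ {u w} (x : Pt S u) (y : Pt S w) → splitPt u (x ++ₚ y) ≡ (x , y)
  splitPt-++ₚ []       y = refl
  splitPt-++ₚ (x ∷ xs) y rewrite splitPt-++ₚ xs y = refl

  data SplitPt (u : List (Fin n)) {w : List (Fin n)} : Pt S (u ++ w) → Set where
    split : (x₁ : Pt S u) (x₂ : Pt S w) → SplitPt u (x₁ ++ₚ x₂)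

  splitPt-view : ∀ u {w} (x : Pt S (u ++ w)) → SplitPt u x
  splitPt-view []      x        = split [] x
  splitPt-view (a ∷ u) (x ∷ xs) with splitPt-view u xs
  ... | split x₁ x₂ = split (x ∷ x₁) x₂

  -- Points over 1-paths that are only propositionally equal (as the two
  -- sides of assoc₀ and unitr₀ are) are compared through their entry lists.
  flatten : ∀ {u} → Pt S u → List (Σ (Fin n) λ a → Σ ℕ (S a))
  flatten []               = []
  flatten {a ∷ u} (x ∷ xs) = (a , x) ∷ flatten xs

  _≅ₚ_ : ∀ {u u′} → Pt S u → Pt S u′ → Set
  x ≅ₚ y = flatten x ≡ flatten y

  flatten-injective : ∀ {u} (x y : Pt S u) → x ≅ₚ y → x ≡ y
  flatten-injective []       []       _  = refl
  flatten-injective (x ∷ xs) (y ∷ ys) eq with ∷-injective eq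
  ... | refl , eqs = cong (x ∷_) (flatten-injective xs ys eqs)

  flatten-++ₚ : ∀ {u w} (x : Pt S u) (y : Pt S w) → flatten (x ++ₚ y) ≡ flatten x ++ flatten y
  flatten-++ₚ []       y = refl
  flatten-++ₚ {a ∷ u} (x ∷ xs) y = cong ((a , x) ∷_) (flatten-++ₚ xs y)

  ++ₚ-cong : ∀ {u w u′ w′} {x : Pt S u} {y : Pt S w} {x′ : Pt S u′} {y′ : Pt S w′} →
             x ≅ₚ x′ → y ≅ₚ y′ → (x ++ₚ y) ≅ₚ (x′ ++ₚ y′)
  ++ₚ-cong {x = x} {y} {x′} {y′} p q = begin
    flatten (x ++ₚ y)          ≡⟨ flatten-++ₚ x y ⟩
    flatten x ++ flatten y     ≡⟨ cong₂ _++_ p q ⟩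
    flatten x′ ++ flatten y′   ≡⟨ flatten-++ₚ x′ y′ ⟨
    flatten (x′ ++ₚ y′)        ∎
    where open ≡-Reasoning

  ++ₚ-assoc : ∀ {u v w} (x : Pt S u) (y : Pt S v) (z : Pt S w) → ((x ++ₚ y) ++ₚ z) ≅ₚ (x ++ₚ (y ++ₚ z))
  ++ₚ-assoc []       y z = refl
  ++ₚ-assoc {a ∷ u} (x ∷ xs) y z = cong ((a , x) ∷_) (++ₚ-assoc xs y z)

  ++ₚ-identityʳ : ∀ {u} (x : Pt S u) → (x ++ₚ []) ≅ₚ x
  ++ₚ-identityʳ []       = refl
  ++ₚ-identityʳ {a ∷ u} (x ∷ xs) = cong ((a , x) ∷_) (++ₚ-identityʳ xs)

module _ {P : Polygraph2} where

  ≈₂-source : ∀ {u v u′ v′} {f : Path2 P u v} {g : Path2 P u′ v′} → f ≈₂ g → u ≡ u′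
  ≈₂-source ≈refl          = refl
  ≈₂-source (≈sym e)       = sym (≈₂-source e)
  ≈₂-source (≈trans e e′)  = trans (≈₂-source e) (≈₂-source e′)
  ≈₂-source (≈cong₀ e e′)  = cong₂ _++_ (≈₂-source e) (≈₂-source e′)
  ≈₂-source (≈cong₁ e e′)  = ≈₂-source e
  ≈₂-source assoc₁         = refl
  ≈₂-source unitl₁         = refl
  ≈₂-source unitr₁         = refl
  ≈₂-source (assoc₀ {u} {v} {u′} {v′} {u″}) = ++-assoc u u′ u″
  ≈₂-source (unitr₀ {u})   = ++-identityʳ u
  ≈₂-source unitl₀         = refl
  ≈₂-source idid₀          = refl
  ≈₂-source exch           = refl

module Semantics {P : Polygraph2} (φ : Interpretation P) where

  ⟦_⟧ᵩ : ∀ {u v} → Path2 P u v → Pt (Sub φ) u → Pt (Sub φ) v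
  ⟦ f ⟧ᵩ = ⟦_⟧ {φ = φ} f

  ⟦⟧-mono : ∀ {u v} (f : Path2 P u v) (x y : Pt (Sub φ) u) → x ≤ₚ y → ⟦ f ⟧ᵩ x ≤ₚ ⟦ f ⟧ᵩ y
  ⟦⟧-mono (gen c)            x y p = mono₂ φ c x y p
  ⟦⟧-mono (idp u)            x y p = p
  ⟦⟧-mono (_⋆₀_ {u = u} f g) x y p with splitPt-mono u x y p
  ... | p₁ , p₂ = ++ₚ-mono _ _ _ _ (⟦⟧-mono f _ _ p₁) (⟦⟧-mono g _ _ p₂)
  ⟦⟧-mono (f ⋆₁ g)           x y p = ⟦⟧-mono g _ _ (⟦⟧-mono f x y p)

  ∂-mono : ∀ {u v} (f : Path2 P u v) (x y : Pt (Sub φ) u) → x ≤ₚ y → ∂ φ f x ≤ ∂ φ f y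
  ∂-mono (gen c)            x y p = ⊔-mono-≤ (maxPt-mono x y p) (maxPt-mono _ _ (mono₂ φ c x y p))
  ∂-mono (idp u)            x y p = z≤n
  ∂-mono (_⋆₀_ {u = u} f g) x y p with splitPt-mono u x y p
  ... | p₁ , p₂ = ⊔-mono-≤ (∂-mono f _ _ p₁) (∂-mono g _ _ p₂)
  ∂-mono (f ⋆₁ g)           x y p = ⊔-mono-≤ (∂-mono f x y p) (∂-mono g _ _ (⟦⟧-mono f x y p))

  ⟦⟧-⋆₀ : ∀ {u v u′ v′} (f : Path2 P u v) (g : Path2 P u′ v′) (x : Pt (Sub φ) u) (y : Pt (Sub φ) u′) →
          ⟦ f ⋆₀ g ⟧ᵩ (x ++ₚ y) ≡ ⟦ f ⟧ᵩ x ++ₚ ⟦ g ⟧ᵩ y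
  ⟦⟧-⋆₀ f g x y = cong (λ (x′ , y′) → ⟦ f ⟧ᵩ x′ ++ₚ ⟦ g ⟧ᵩ y′) (splitPt-++ₚ x y)

  ∂-⋆₀ : ∀ {u v u′ v′} (f : Path2 P u v) (g : Path2 P u′ v′) (x : Pt (Sub φ) u) (y : Pt (Sub φ) u′) →
         ∂ φ (f ⋆₀ g) (x ++ₚ y) ≡ ∂ φ f x ⊔ ∂ φ g y
  ∂-⋆₀ f g x y = cong (λ (x′ , y′) → ∂ φ f x′ ⊔ ∂ φ g y′) (splitPt-++ₚ x y)

  ⟦⟧-resp-≈₂ : ∀ {u v u′ v′} {f : Path2 P u v} {g : Path2 P u′ v′} → f ≈₂ g →
               (x : Pt (Sub φ) u) (x′ : Pt (Sub φ) u′) → x ≅ₚ x′ → ⟦ f ⟧ᵩ x ≅ₚ ⟦ g ⟧ᵩ x′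
  ⟦⟧-resp-≈₂ ≈refl x x′ eq with flatten-injective x x′ eq
  ... | refl = refl
  ⟦⟧-resp-≈₂ (≈sym e) x x′ eq = sym (⟦⟧-resp-≈₂ e x′ x (sym eq))
  ⟦⟧-resp-≈₂ (≈trans e e′) x x′ eq with ≈₂-source e
  ... | refl = trans (⟦⟧-resp-≈₂ e x x refl) (⟦⟧-resp-≈₂ e′ x x′ eq)
  ⟦⟧-resp-≈₂ (≈cong₀ e e′) x x′ eq with ≈₂-source e | ≈₂-source e′
  ... | refl | refl with flatten-injective x x′ eq
  ... | refl = ++ₚ-cong (⟦⟧-resp-≈₂ e _ _ refl) (⟦⟧-resp-≈₂ e′ _ _ refl)
  ⟦⟧-resp-≈₂ (≈cong₁ {f = f} {f′} e e′) x x′ eq =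
    ⟦⟧-resp-≈₂ e′ (⟦ f ⟧ᵩ x) (⟦ f′ ⟧ᵩ x′) (⟦⟧-resp-≈₂ e x x′ eq)
  ⟦⟧-resp-≈₂ assoc₁ x x′ eq with flatten-injective x x′ eq
  ... | refl = refl
  ⟦⟧-resp-≈₂ unitl₁ x x′ eq with flatten-injective x x′ eq
  ... | refl = refl
  ⟦⟧-resp-≈₂ unitr₁ x x′ eq with flatten-injective x x′ eq
  ... | refl = refl
  ⟦⟧-resp-≈₂ (assoc₀ {u} {_} {u′} {f = f} {g = g} {h = h}) x x′ eq with splitPt-view (u ++ u′) x
  ... | split y x₃ with splitPt-view u y
  ... | split x₁ x₂ with flatten-injective x′ (x₁ ++ₚ (x₂ ++ₚ x₃)) (trans (sym eq) (++ₚ-assoc x₁ x₂ x₃))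
  ... | refl = begin
    flatten (⟦ (f ⋆₀ g) ⋆₀ h ⟧ᵩ ((x₁ ++ₚ x₂) ++ₚ x₃))
      ≡⟨ cong flatten (⟦⟧-⋆₀ (f ⋆₀ g) h (x₁ ++ₚ x₂) x₃) ⟩
    flatten (⟦ f ⋆₀ g ⟧ᵩ (x₁ ++ₚ x₂) ++ₚ ⟦ h ⟧ᵩ x₃)
      ≡⟨ cong (λ y → flatten (y ++ₚ ⟦ h ⟧ᵩ x₃)) (⟦⟧-⋆₀ f g x₁ x₂) ⟩
    flatten ((⟦ f ⟧ᵩ x₁ ++ₚ ⟦ g ⟧ᵩ x₂) ++ₚ ⟦ h ⟧ᵩ x₃)
      ≡⟨ ++ₚ-assoc (⟦ f ⟧ᵩ x₁) (⟦ g ⟧ᵩ x₂) (⟦ h ⟧ᵩ x₃) ⟩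
    flatten (⟦ f ⟧ᵩ x₁ ++ₚ (⟦ g ⟧ᵩ x₂ ++ₚ ⟦ h ⟧ᵩ x₃))
      ≡⟨ cong (λ y → flatten (⟦ f ⟧ᵩ x₁ ++ₚ y)) (⟦⟧-⋆₀ g h x₂ x₃) ⟨
    flatten (⟦ f ⟧ᵩ x₁ ++ₚ ⟦ g ⋆₀ h ⟧ᵩ (x₂ ++ₚ x₃))
      ≡⟨ cong flatten (⟦⟧-⋆₀ f (g ⋆₀ h) x₁ (x₂ ++ₚ x₃)) ⟨
    flatten (⟦ f ⋆₀ (g ⋆₀ h) ⟧ᵩ (x₁ ++ₚ (x₂ ++ₚ x₃)))
      ∎
    where open ≡-Reasoning
  ⟦⟧-resp-≈₂ unitl₀ x x′ eq with flatten-injective x x′ eq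
  ... | refl = refl
  ⟦⟧-resp-≈₂ (unitr₀ {u} {f = f}) x x′ eq with splitPt-view u x
  ... | split x₁ [] with flatten-injective x′ x₁ (trans (sym eq) (++ₚ-identityʳ x₁))
  ... | refl = trans (cong flatten (⟦⟧-⋆₀ f (idp []) x₁ [])) (++ₚ-identityʳ (⟦ f ⟧ᵩ x₁))
  ⟦⟧-resp-≈₂ (idid₀ {u} {v}) x x′ eq with flatten-injective x x′ eq
  ... | refl with splitPt-view u x
  ... | split x₁ x₂ = cong flatten (⟦⟧-⋆₀ (idp u) (idp v) x₁ x₂)
  ⟦⟧-resp-≈₂ (exch {g = g} {g' = g′}) x x′ eq with flatten-injective x x′ eq
  ... | refl = cong flatten (⟦⟧-⋆₀ g g′ _ _)

  ∂-resp-≈₂ : ∀ {u v u′ v′} {f : Path2 P u v} {g : Path2 P u′ v′} → f ≈₂ g →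
              (x : Pt (Sub φ) u) (x′ : Pt (Sub φ) u′) → x ≅ₚ x′ → ∂ φ f x ≡ ∂ φ g x′
  ∂-resp-≈₂ ≈refl x x′ eq with flatten-injective x x′ eq
  ... | refl = refl
  ∂-resp-≈₂ (≈sym e) x x′ eq = sym (∂-resp-≈₂ e x′ x (sym eq))
  ∂-resp-≈₂ (≈trans e e′) x x′ eq with ≈₂-source e
  ... | refl = trans (∂-resp-≈₂ e x x refl) (∂-resp-≈₂ e′ x x′ eq)
  ∂-resp-≈₂ (≈cong₀ e e′) x x′ eq with ≈₂-source e | ≈₂-source e′
  ... | refl | refl with flatten-injective x x′ eq
  ... | refl = cong₂ _⊔_ (∂-resp-≈₂ e _ _ refl) (∂-resp-≈₂ e′ _ _ refl)
  ∂-resp-≈₂ (≈cong₁ {f = f} {f′} e e′) x x′ eq =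
    cong₂ _⊔_ (∂-resp-≈₂ e x x′ eq) (∂-resp-≈₂ e′ (⟦ f ⟧ᵩ x) (⟦ f′ ⟧ᵩ x′) (⟦⟧-resp-≈₂ e x x′ eq))
  ∂-resp-≈₂ (assoc₁ {f = f} {g} {h}) x x′ eq with flatten-injective x x′ eq
  ... | refl = ⊔-assoc (∂ φ f x) (∂ φ g (⟦ f ⟧ᵩ x)) (∂ φ h (⟦ g ⟧ᵩ (⟦ f ⟧ᵩ x)))
  ∂-resp-≈₂ unitl₁ x x′ eq with flatten-injective x x′ eq
  ... | refl = refl
  ∂-resp-≈₂ unitr₁ x x′ eq with flatten-injective x x′ eq
  ... | refl = ⊔-identityʳ _
  ∂-resp-≈₂ (assoc₀ {u} {_} {u′} {f = f} {g = g} {h = h}) x x′ eq with splitPt-view (u ++ u′) x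
  ... | split y x₃ with splitPt-view u y
  ... | split x₁ x₂ with flatten-injective x′ (x₁ ++ₚ (x₂ ++ₚ x₃)) (trans (sym eq) (++ₚ-assoc x₁ x₂ x₃))
  ... | refl = begin
    ∂ φ ((f ⋆₀ g) ⋆₀ h) ((x₁ ++ₚ x₂) ++ₚ x₃)     ≡⟨ ∂-⋆₀ (f ⋆₀ g) h (x₁ ++ₚ x₂) x₃ ⟩
    ∂ φ (f ⋆₀ g) (x₁ ++ₚ x₂) ⊔ ∂ φ h x₃           ≡⟨ cong (_⊔ ∂ φ h x₃) (∂-⋆₀ f g x₁ x₂) ⟩
    (∂ φ f x₁ ⊔ ∂ φ g x₂) ⊔ ∂ φ h x₃             ≡⟨ ⊔-assoc (∂ φ f x₁) (∂ φ g x₂) (∂ φ h x₃) ⟩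
    ∂ φ f x₁ ⊔ (∂ φ g x₂ ⊔ ∂ φ h x₃)             ≡⟨ cong (∂ φ f x₁ ⊔_) (∂-⋆₀ g h x₂ x₃) ⟨
    ∂ φ f x₁ ⊔ ∂ φ (g ⋆₀ h) (x₂ ++ₚ x₃)          ≡⟨ ∂-⋆₀ f (g ⋆₀ h) x₁ (x₂ ++ₚ x₃) ⟨
    ∂ φ (f ⋆₀ (g ⋆₀ h)) (x₁ ++ₚ (x₂ ++ₚ x₃))     ∎
    where open ≡-Reasoning
  ∂-resp-≈₂ unitl₀ x x′ eq with flatten-injective x x′ eq
  ... | refl = refl
  ∂-resp-≈₂ (unitr₀ {u} {f = f}) x x′ eq with splitPt-view u x
  ... | split x₁ [] with flatten-injective x′ x₁ (trans (sym eq) (++ₚ-identityʳ x₁))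
  ... | refl = trans (∂-⋆₀ f (idp []) x₁ []) (⊔-identityʳ (∂ φ f x₁))
  ∂-resp-≈₂ idid₀ x x′ eq with flatten-injective x x′ eq
  ... | refl = refl
  ∂-resp-≈₂ (exch {u} {f = f} {g} {f′} {g′}) x x′ eq with flatten-injective x x′ eq
  ... | refl = trans (cong (∂ φ f x₁ ⊔ ∂ φ f′ x₂ ⊔_) (∂-⋆₀ g g′ (⟦ f ⟧ᵩ x₁) (⟦ f′ ⟧ᵩ x₂)))
                     (interchange (∂ φ f x₁) (∂ φ f′ x₂) (∂ φ g (⟦ f ⟧ᵩ x₁)) (∂ φ g′ (⟦ f′ ⟧ᵩ x₂)))
    where
      x₁ = proj₁ (splitPt u x)
      x₂ = proj₂ (splitPt u x)

module _ (Π : Polygraph3) (φ : Interpretation (P2 Π)) where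
  open Semantics φ

  ⟦⟧-decreasing : Compatible Π φ → ∀ {u v} {f g : Path2 (P2 Π) u v} → Path3 Π f g →
                  ∀ (x : Pt (Sub φ) u) → ⟦ g ⟧ᵩ x ≤ₚ ⟦ f ⟧ᵩ x
  ⟦⟧-decreasing compatible (gen3 α)   x = compatible α x
  ⟦⟧-decreasing compatible (conv e)   x =
    ≤ₚ-reflexive (flatten-injective _ _ (⟦⟧-resp-≈₂ (≈sym e) x x refl))
  ⟦⟧-decreasing compatible (_⋆₀³_ {u = u} F G) x =
    ++ₚ-mono _ _ _ _ (⟦⟧-decreasing compatible F (proj₁ (splitPt u x)))
                     (⟦⟧-decreasing compatible G (proj₂ (splitPt u x)))
  ⟦⟧-decreasing compatible (_⋆₁³_ {f = f} {g' = g′} F G) x =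
    ≤ₚ-trans _ _ _ (⟦⟧-mono g′ _ _ (⟦⟧-decreasing compatible F x))
                   (⟦⟧-decreasing compatible G (⟦ f ⟧ᵩ x))
  ⟦⟧-decreasing compatible (F ⋆₂³ G)  x =
    ≤ₚ-trans _ _ _ (⟦⟧-decreasing compatible G x) (⟦⟧-decreasing compatible F x)

proposition2p24 : (Π : Polygraph3) (φ : Interpretation (P2 Π)) →
    Compatible Π φ → Conservative Π φ →
    ∀ {u v} {f g : Path2 (P2 Π) u v} → Path3 Π f g →
    ∀ (x : Pt (Sub φ) u) → ∂ φ g x ≤ ∂ φ f x
proposition2p24 Π φ compatible conservative = ∂-decreasing
  where
    open Semantics φ

    ∂-decreasing : ∀ {u v} {f g : Path2 (P2 Π) u v} → Path3 Π f g →
                   ∀ (x : Pt (Sub φ) u) → ∂ φ g x ≤ ∂ φ f x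
    ∂-decreasing (gen3 α) x = conservative α x
    ∂-decreasing (conv e) x = ≤-reflexive (∂-resp-≈₂ (≈sym e) x x refl)
    ∂-decreasing (_⋆₀³_ {u = u} F G) x =
      ⊔-mono-≤ (∂-decreasing F (proj₁ (splitPt u x))) (∂-decreasing G (proj₂ (splitPt u x)))
    ∂-decreasing (_⋆₁³_ {f = f} {g' = g′} F G) x =
      ⊔-mono-≤ (∂-decreasing F x)
               (≤-trans (∂-mono g′ _ _ (⟦⟧-decreasing Π φ compatible F x)) (∂-decreasing G (⟦ f ⟧ᵩ x)))
    ∂-decreasing (F ⋆₂³ G) x = ≤-trans (∂-decreasing G x) (∂-decreasing F x)
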